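{- Let $k\geq 2$ be an integer. If $G$ is a $k$-leaf power, then $\mathrm{box}(G)\leq k-1$.
   Context: All graphs are simple, undirected and finite. A graph $G$ is a $k$-leaf power if there exists a tree $T$ and a bijection between $V(G)$ and the set of leaves of $T$ such that two vertices of $G$ are adjacent iff the distance in $T$ between their corresponding leaves is at most $k$. The boxicity $\mathrm{box}(G)$ of a graph $G$ is the minimum integer $t$ such that there is a map assigning to each vertex an axis-parallel $t$-dimensional box (a Cartesian product of $t$ closed real intervals) such that two distinct vertices are adjacent iff their boxes intersect. -}

module Defs where

open import Data.Nat using (ℕ; zero; suc; _+_; _≤_; _%_)
open import Data.Fin using (Fin; toℕ)
open import Data.Product using (Σ; ∃; _×_; _,_)
open import Data.Rational using (ℚ) renaming (_≤_ to _≤ℚ_)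
open import Relation.Binary.PropositionalEquality using (_≡_; _≢_)
open import Relation.Nullary using (¬_)
open import Function.Bundles using (_⇔_)
open import Function.Definitions using (Injective)

record Graph : Set₁ where
  field
    n      : ℕ
    Adj    : Fin n → Fin n → Set
    sym    : ∀ {u v} → Adj u v → Adj v u
    irrefl : ∀ {u} → ¬ Adj u u
open Graph public

module _ (G : Graph) where
  private V = Fin (n G)

  data Walk : V → V → ℕ → Set where
    nil  : ∀ {u} → Walk u u 0
    cons : ∀ {u w v l} → Adj G u w → Walk w v l → Walk u (v) (suc l)

  DistLe : V → V → ℕ → Set
  DistLe u v d = ∃ λ l → l ≤ d × Walk u v l

  Connected : Set
  Connected = ∀ u v → ∃ λ l → Walk u v l

  Cycle : Set
  Cycle = Σ ℕ λ l → Σ (Fin (3 + l) → V) λ c →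
            Injective _≡_ _≡_ c ×
            (∀ i j → toℕ j ≡ suc (toℕ i) % (3 + l) → Adj G (c i) (c j))

  Acyclic : Set
  Acyclic = ¬ Cycle

  IsTree : Set
  IsTree = Connected × Acyclic

  IsLeaf : V → Set
  IsLeaf v = ∃ λ w → Adj G v w × (∀ w' → Adj G v w' → w' ≡ w)

IsLeafPower : ℕ → Graph → Set₁
IsLeafPower k G = Σ Graph λ T → IsTree T × Σ (Fin (n G) → Fin (n T)) λ f →
  Injective _≡_ _≡_ f ×
  (∀ v → IsLeaf T (f v)) ×
  (∀ x → IsLeaf T x → ∃ λ v → f v ≡ x) ×
  (∀ u v → u ≢ v → (Adj G u v ⇔ DistLe T (f u) (f v) k))

record Box (t : ℕ) : Set where
  field
    lo hi : Fin t → ℚ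
    lo≤hi : ∀ i → lo i ≤ℚ hi i
open Box public

Intersect : ∀ {t} → Box t → Box t → Set
Intersect B C = ∀ i → (lo B i ≤ℚ hi C i) × (lo C i ≤ℚ hi B i)

BoxRep : Graph → ℕ → Set
BoxRep G t = Σ (Fin (n G) → Box t) λ b →
  ∀ u v → u ≢ v → (Adj G u v ⇔ Intersect (b u) (b v))

BoxicityLe : Graph → ℕ → Set
BoxicityLe G t = ∃ λ s → s ≤ t × BoxRep G s

module Submission where

-- Root T at the neighbour ρ
-- of some leaf; if ρ is itself a leaf, T is a single edge and G is complete.
-- Order the leaves depth-first, comparing lexicographically the vertex keys
-- along their root paths, with keys chosen so that leaf children come before
-- inner children; rank is the position in this order, and [start x , end x]
-- is the hull of the ranks of the leaves below a vertex x.  In coordinate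
-- i < d the box of a leaf u is [start (ancestor (d - i) u) , end (ancestor i u)].
-- If the root paths of two leaves u, v fork at w with branches of lengths
-- du, dv, and u's branch comes first, then their boxes meet in coordinate i
-- iff du ≤ i or dv ≤ d - i.  This holds for every i iff du + dv ≤ d + 1,
-- using that dv = 1 forces du = 1 (leaf children come first), and du + dv is
-- the distance of u and v in T.

open import Defs hiding (sym)
open import Data.Nat as ℕ using (ℕ; zero; suc; _+_; _∸_; _≤_; _<_; z≤n; s≤s; _<?_)
import Data.Nat.Properties as ℕP
open import Data.Nat.DivMod using (_%_; n%n≡0; m<n⇒m%n≡m)
open import Data.Fin as Fin using (Fin; toℕ)
import Data.Fin.Properties as FinP
open import Data.List using (List; []; _∷_; _++_; length; map; filter; allFin; reverse; _∷ʳ_; _∷ʳ′_; initLast)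
open import Data.List.Properties using (++-identityʳ; ++-assoc; map-++; reverse-++; unfold-reverse; length-filter; ∷-injective; ∷-injectiveˡ; ∷-injectiveʳ)
open import Data.List.Relation.Unary.Any as Any using (Any; here; there)
import Data.List.Relation.Unary.Any.Properties as Any
open import Data.List.Relation.Unary.All as All using (All)
import Data.List.Relation.Unary.All.Properties as All
open import Data.List.Extrema.Nat using (min; max; min≤v⁺; v≤max⁺; max<v⁺; v<min⁺)
open import Data.List.Relation.Unary.Linked as Linked using (Linked; []; [-]; _∷_)
open import Data.List.Membership.Propositional using (_∈_; _∉_)
open import Data.List.Relation.Binary.Subset.Propositional using (_⊆_)
open import Data.List.Membership.Propositional.Properties using (∈-++⁺ˡ; ∈-++⁺ʳ; ∈-++⁻; ∈-allFin; ∈-filter⁺; ∈-filter⁻)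
import Data.List.Membership.DecPropositional as DecMembership
open import Data.Product using (Σ; ∃; _×_; _,_; proj₁; proj₂)
open import Data.Sum using (_⊎_; inj₁; inj₂)
open import Data.Empty using (⊥; ⊥-elim)
open import Function using (_∘_; _⇔_; mk⇔; Equivalence)
open import Function.Definitions using (Injective)
import Function.Properties.Equivalence as ⇔
open import Relation.Binary.Definitions using (tri<; tri≈; tri>)
open import Relation.Nullary using (¬_; Dec; yes; no)
open import Data.List.Relation.Binary.Lex.Strict as Lex using (Lex-<)
import Data.List.Relation.Binary.Pointwise as Pointwise
import Data.Integer as ℤ
import Data.Integer.Properties as ℤP
open import Data.Rational using (ℚ; mkℚ; *≤*) renaming (_≤_ to _≤ℚ_)
open import Data.Nat.Coprimality as Coprime using (1-coprimeTo)
open import Relation.Unary using (Decidable)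
open import Relation.Binary using (Transitive) renaming (Decidable to Decidable₂)
open import Relation.Binary.PropositionalEquality

module _ {A : Set} where

  data Distinct : List A → Set where
    []  : Distinct []
    _∷_ : ∀ {x xs} → x ∉ xs → Distinct xs → Distinct (x ∷ xs)

  distinct-++ʳ : ∀ xs {ys} → Distinct (xs ++ ys) → Distinct ys
  distinct-++ʳ []       d       = d
  distinct-++ʳ (x ∷ xs) (_ ∷ d) = distinct-++ʳ xs d

  distinct-disjoint : ∀ xs {ys z} → Distinct (xs ++ ys) → z ∈ xs → z ∉ ys
  distinct-disjoint (x ∷ xs) (x∉ ∷ _) (here refl) z∈ys = x∉ (∈-++⁺ʳ xs z∈ys)
  distinct-disjoint (x ∷ xs) (_ ∷ d)  (there z∈xs) z∈ys = distinct-disjoint xs d z∈xs z∈ys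

  distinct-prefix : ∀ B B' {w r r'} → Distinct (B ++ w ∷ r) → B ++ w ∷ r ≡ B' ++ w ∷ r' → B ≡ B'
  distinct-prefix []      []        _          _  = refl
  distinct-prefix []      (b ∷ B') (w∉ ∷ _) eq with ∷-injective eq
  ... | refl , eq' = ⊥-elim (w∉ (subst (_ ∈_) (sym eq') (∈-++⁺ʳ B' (here refl))))
  distinct-prefix (b ∷ B) []        (b∉ ∷ _) eq with ∷-injectiveˡ eq
  ... | refl = ⊥-elim (b∉ (∈-++⁺ʳ B (here refl)))
  distinct-prefix (b ∷ B) (b' ∷ B') (_ ∷ d)  eq with ∷-injective eq
  ... | refl , eq' = cong (b ∷_) (distinct-prefix B B' d eq')

  suffix-from-earlier : ∀ pre C {a t c S} → Distinct (pre ++ a ∷ t) → a ∈ C ++ c ∷ [] →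
                        pre ++ a ∷ t ≡ C ++ c ∷ S → ∃ λ C' → a ∷ t ≡ C' ++ c ∷ S
  suffix-from-earlier []        C _        _            eq = C , eq
  suffix-from-earlier (p ∷ pre) [] (p∉ ∷ _) (here refl) eq with ∷-injectiveˡ eq
  ... | refl = ⊥-elim (p∉ (∈-++⁺ʳ pre (here refl)))
  suffix-from-earlier (p ∷ pre) (q ∷ C) (p∉ ∷ _) (here refl) eq with ∷-injectiveˡ eq
  ... | refl = ⊥-elim (p∉ (∈-++⁺ʳ pre (here refl)))
  suffix-from-earlier (p ∷ pre) (q ∷ C) (_ ∷ d)  (there a∈) eq =
    suffix-from-earlier pre C d a∈ (∷-injectiveʳ eq)

  nonempty-length : ∀ {x : A} {xs} → x ∈ xs → 1 ≤ length xs
  nonempty-length (here _)  = s≤s z≤n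
  nonempty-length (there _) = s≤s z≤n

  last-view : ∀ {a : A} xs → a ∈ xs → ∃ λ ys → ∃ λ y → xs ≡ ys ++ y ∷ []
  last-view xs a∈ with initLast xs
  last-view .[]        () | []
  last-view .(ys ∷ʳ y) _  | ys ∷ʳ′ y = ys , y , refl

  head∈prefix : ∀ {x : A} {r} ys {y S} → x ∷ r ≡ (ys ++ y ∷ []) ++ S → x ∈ ys ++ y ∷ []
  head∈prefix []       eq = here (∷-injectiveˡ eq)
  head∈prefix (_ ∷ ys) eq = here (∷-injectiveˡ eq)

  single-last : ∀ ys {y : A} → length (ys ++ y ∷ []) ≡ 1 → ys ≡ []
  single-last []           _  = refl
  single-last (_ ∷ [])     ()
  single-last (_ ∷ _ ∷ _) ()

  nth : A → List A → ℕ → A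
  nth d []       _       = d
  nth d (x ∷ xs) zero    = x
  nth d (x ∷ xs) (suc j) = nth d xs j

  nth-∈ : ∀ d xs j → nth d xs j ∈ xs ⊎ nth d xs j ≡ d
  nth-∈ d []       j       = inj₂ refl
  nth-∈ d (x ∷ xs) zero    = inj₁ (here refl)
  nth-∈ d (x ∷ xs) (suc j) with nth-∈ d xs j
  ... | inj₁ m  = inj₁ (there m)
  ... | inj₂ eq = inj₂ eq

  nth-∈-prefix : ∀ d xs {ys} j → j < length xs → nth d (xs ++ ys) j ∈ xs
  nth-∈-prefix d (x ∷ xs) zero    _         = here refl
  nth-∈-prefix d (x ∷ xs) (suc j) (s≤s j<) = there (nth-∈-prefix d xs j j<)

  nth-skip-prefix : ∀ d xs {ys} j → length xs ≤ j → nth d (xs ++ ys) j ≡ nth d ys (j ∸ length xs)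
  nth-skip-prefix d []       j       _         = refl
  nth-skip-prefix d (x ∷ xs) (suc j) (s≤s ≤j) = nth-skip-prefix d xs j ≤j

  nth-∈-bounded : ∀ {d} xs j → j < length xs → nth d xs j ∈ xs
  nth-∈-bounded {d} xs j j< =
    subst (λ l → nth d l j ∈ xs) (++-identityʳ xs) (nth-∈-prefix d xs j j<)

  nth-injective : ∀ {d} xs i j → Distinct xs → i < length xs → j < length xs →
                  nth d xs i ≡ nth d xs j → i ≡ j
  nth-injective (x ∷ xs) zero    zero    _        _        _        _  = refl
  nth-injective (x ∷ xs) zero    (suc j) (x∉ ∷ _) _        (s≤s j<) eq =
    ⊥-elim (x∉ (subst (_∈ xs) (sym eq) (nth-∈-bounded xs j j<)))
  nth-injective (x ∷ xs) (suc i) zero    (x∉ ∷ _) (s≤s i<) _        eq =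
    ⊥-elim (x∉ (subst (_∈ xs) eq (nth-∈-bounded xs i i<)))
  nth-injective (x ∷ xs) (suc i) (suc j) (_ ∷ d)  (s≤s i<) (s≤s j<) eq =
    cong suc (nth-injective xs i j d i< j< eq)

  linked-++ʳ : ∀ {R : A → A → Set} xs {ys} → Linked R (xs ++ ys) → Linked R ys
  linked-++ʳ []       l = l
  linked-++ʳ (x ∷ xs) l = linked-++ʳ xs (Linked.tail l)

  nth-linked : ∀ {R : A → A → Set} {d} xs i → Linked R xs → suc i < length xs →
               R (nth d xs i) (nth d xs (suc i))
  nth-linked (x ∷ [])     _       [-]      (s≤s ())
  nth-linked (x ∷ y ∷ xs) zero    (r ∷ _)  _         = r
  nth-linked (x ∷ y ∷ xs) (suc i) (_ ∷ rs) (s≤s i<) = nth-linked (y ∷ xs) i rs i<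

reverse-map-split : ∀ {A B : Set} (g : A → B) X c Y →
                    reverse (map g (X ++ c ∷ Y)) ≡ reverse (map g Y) ++ g c ∷ reverse (map g X)
reverse-map-split g X c Y = begin
  reverse (map g (X ++ c ∷ Y))                        ≡⟨ cong reverse (map-++ g X (c ∷ Y)) ⟩
  reverse (map g X ++ g c ∷ map g Y)                  ≡⟨ reverse-++ (map g X) (g c ∷ map g Y) ⟩
  reverse (g c ∷ map g Y) ++ reverse (map g X)        ≡⟨ cong (_++ reverse (map g X)) (unfold-reverse (g c) (map g Y)) ⟩
  (reverse (map g Y) ++ g c ∷ []) ++ reverse (map g X) ≡⟨ ++-assoc (reverse (map g Y)) (g c ∷ []) (reverse (map g X)) ⟩
  reverse (map g Y) ++ g c ∷ reverse (map g X)        ∎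
  where open ≡-Reasoning

-- Walks, paths and cycles in a graph.

module Walks (T : Graph) where

  V : Set
  V = Fin (n T)

  _~_ : V → V → Set
  _~_ = Adj T

  _∈?_ : (x : V) (xs : List V) → Dec (x ∈ xs)
  _∈?_ = DecMembership._∈?_ FinP._≟_

  vertices : ∀ {x y l} → Walk T x y l → List V
  vertices {x} nil        = x ∷ []
  vertices {x} (cons _ w) = x ∷ vertices w

  vertices-head : ∀ {x y l} (w : Walk T x y l) → ∃ λ r → vertices w ≡ x ∷ r
  vertices-head nil        = _ , refl
  vertices-head (cons _ w) = _ , refl

  end∈vertices : ∀ {x y l} (w : Walk T x y l) → y ∈ vertices w
  end∈vertices nil        = here refl
  end∈vertices (cons _ w) = there (end∈vertices w)

  length-vertices : ∀ {x y l} (w : Walk T x y l) → length (vertices w) ≡ suc l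
  length-vertices nil        = refl
  length-vertices (cons _ w) = cong suc (length-vertices w)

  nth-end : ∀ {x y l} d (w : Walk T x y l) → nth d (vertices w) l ≡ y
  nth-end d nil        = refl
  nth-end d (cons _ w) = nth-end d w

  vertices-linked : ∀ {x y l} (w : Walk T x y l) → Linked _~_ (vertices w)
  vertices-linked nil                = [-]
  vertices-linked (cons e nil)       = e ∷ [-]
  vertices-linked (cons e (cons e' w)) = e ∷ vertices-linked (cons e' w)

  walk-along : ∀ x pre z r → Linked _~_ (x ∷ pre ++ z ∷ r) → Walk T x z (suc (length pre))
  walk-along x []        z r (e ∷ _)  = cons e nil
  walk-along x (p ∷ pre) z r (e ∷ es) = cons e (walk-along p pre z r es)

  _++ʷ_ : ∀ {x y z l m} → Walk T x y l → Walk T y z m → Walk T x z (l + m)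
  nil      ++ʷ q = q
  cons e p ++ʷ q = cons e (p ++ʷ q)

  ∈-++ʷ : ∀ {x y z l m v} (p : Walk T x y l) (q : Walk T y z m) →
          v ∈ vertices (p ++ʷ q) → v ∈ vertices p ⊎ v ∈ vertices q
  ∈-++ʷ nil        q v∈           = inj₂ v∈
  ∈-++ʷ (cons e p) q (here refl)  = inj₁ (here refl)
  ∈-++ʷ (cons e p) q (there v∈) with ∈-++ʷ p q v∈
  ... | inj₁ v∈p = inj₁ (there v∈p)
  ... | inj₂ v∈q = inj₂ v∈q

  snocʷ : ∀ {x y z l} → Walk T x y l → y ~ z → Walk T x z (suc l)
  snocʷ nil        e = cons e nil
  snocʷ (cons e' w) e = cons e' (snocʷ w e)

  ∈-snocʷ : ∀ {x y z l v} (w : Walk T x y l) (e : y ~ z) →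
            v ∈ vertices (snocʷ w e) → v ∈ vertices w ⊎ v ≡ z
  ∈-snocʷ nil         e (here refl)         = inj₁ (here refl)
  ∈-snocʷ nil         e (there (here refl)) = inj₂ refl
  ∈-snocʷ (cons e' w) e (here refl)         = inj₁ (here refl)
  ∈-snocʷ (cons e' w) e (there v∈) with ∈-snocʷ w e v∈
  ... | inj₁ v∈w = inj₁ (there v∈w)
  ... | inj₂ v≡z = inj₂ v≡z

  reverseʷ : ∀ {x y l} → Walk T x y l → Walk T y x l
  reverseʷ nil        = nil
  reverseʷ (cons e w) = snocʷ (reverseʷ w) (Graph.sym T e)

  ∈-reverseʷ : ∀ {x y l v} (w : Walk T x y l) → v ∈ vertices (reverseʷ w) → v ∈ vertices w
  ∈-reverseʷ nil v∈ = v∈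
  ∈-reverseʷ (cons e w) v∈ with ∈-snocʷ (reverseʷ w) (Graph.sym T e) v∈
  ... | inj₁ v∈r   = there (∈-reverseʷ w v∈r)
  ... | inj₂ refl  = here refl

  drop-until : ∀ {x y z l} (w : Walk T y z l) → x ∈ vertices w →
               ∃ λ l' → Σ (Walk T x z l') λ d → ∃ λ pre → vertices w ≡ pre ++ vertices d
  drop-until nil         (here refl) = _ , nil , [] , refl
  drop-until (cons e w)  (here refl) = _ , cons e w , [] , refl
  drop-until {y = y} (cons e w) (there x∈) with drop-until w x∈
  ... | l' , d , pre , eq = l' , d , y ∷ pre , cong (y ∷_) eq

  Path : V → V → Set
  Path x y = ∃ λ l → Σ (Walk T x y l) λ w → Distinct (vertices w)

  path-vertices : ∀ {x y} → Path x y → List V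
  path-vertices (_ , w , _) = vertices w

  to-path : ∀ {x y l} (w : Walk T x y l) → Σ (Path x y) λ p → path-vertices p ⊆ vertices w
  to-path nil = (0 , nil , (λ ()) ∷ []) , λ v∈ → v∈
  to-path {x} (cons e w) with to-path w
  ... | (l , p , dp) , p⊆w with x ∈? vertices p
  ...   | yes x∈p with drop-until p x∈p
  ...     | l' , d , pre , eq =
              (l' , d , distinct-++ʳ pre (subst Distinct eq dp)) ,
              λ v∈ → there (p⊆w (subst (_ ∈_) (sym eq) (∈-++⁺ʳ pre v∈)))
  to-path {x} (cons e w) | (l , p , dp) , p⊆w | no x∉p =
    (suc l , cons e p , x∉p ∷ dp) , λ { (here refl) → here refl ; (there v∈) → there (p⊆w v∈) }

  closed-chain-cycle : ∀ {d} L l → length L ≡ 3 + l → Distinct L → Linked _~_ L →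
                       nth d L (2 + l) ~ nth d L 0 → Cycle T
  closed-chain-cycle {d} L l len dL linked closing = l , c , c-injective , c-adjacent
    where
    c : Fin (3 + l) → V
    c i = nth d L (toℕ i)

    in-range : ∀ (i : Fin (3 + l)) → toℕ i < length L
    in-range i = subst (toℕ i <_) (sym len) (FinP.toℕ<n i)

    c-injective : ∀ {i j} → c i ≡ c j → i ≡ j
    c-injective {i} {j} eq =
      FinP.toℕ-injective (nth-injective L (toℕ i) (toℕ j) dL (in-range i) (in-range j) eq)

    c-adjacent : ∀ i j → toℕ j ≡ suc (toℕ i) % (3 + l) → c i ~ c j
    c-adjacent i j j≡ with suc (toℕ i) <? 3 + l
    ... | yes i+1< rewrite m<n⇒m%n≡m {n = 3 + l} i+1< | j≡ =
          nth-linked L (toℕ i) linked (subst (suc (toℕ i) <_) (sym len) i+1<)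
    ... | no i+1≮ = subst₂ _~_ (cong (nth d L) (sym i≡last)) (cong (nth d L) (sym j≡0)) closing
      where
      i+1≡ : suc (toℕ i) ≡ 3 + l
      i+1≡ = ℕP.≤-antisym (FinP.toℕ<n i) (ℕP.≮⇒≥ i+1≮)
      i≡last : toℕ i ≡ 2 + l
      i≡last = cong ℕ.pred i+1≡
      j≡0 : toℕ j ≡ 0
      j≡0 = trans j≡ (trans (cong (_% (3 + l)) i+1≡) (n%n≡0 (3 + l)))

  close-path : ∀ {x a b l} (p : Walk T a b l) → Distinct (vertices p) → a ≢ b →
               x ∉ vertices p → x ~ a → b ~ x → Cycle T
  close-path nil _ a≢b _ _ _ = ⊥-elim (a≢b refl)
  close-path {x} p@(cons {l = l} _ _) dp _ x∉p xa bx =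
    closed-chain-cycle {x} (x ∷ vertices p) l (cong suc (length-vertices p))
      (x∉p ∷ dp) (xa ∷ vertices-linked p) (subst (_~ x) (sym (nth-end x p)) bx)

  module Forest (acyclic : Acyclic T) where

    -- In an acyclic graph a path is determined by its ends: two different
    -- first steps would close a cycle.
    path-unique : ∀ {x y l m} (p : Walk T x y l) (q : Walk T x y m) →
                  Distinct (vertices p) → Distinct (vertices q) → vertices p ≡ vertices q
    path-unique nil        nil        _ _                = refl
    path-unique nil        (cons _ q) _ (x∉q ∷ _)        = ⊥-elim (x∉q (end∈vertices q))
    path-unique (cons _ p) nil        (x∉p ∷ _) _        = ⊥-elim (x∉p (end∈vertices p))
    path-unique {x} (cons {w = a} xa p) (cons {w = b} xb q) (x∉p ∷ dp) (x∉q ∷ dq) with a FinP.≟ b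
    ... | yes refl = cong (x ∷_) (path-unique p q dp dq)
    ... | no a≢b with to-path (p ++ʷ reverseʷ q)
    ...   | (_ , r , dr) , r⊆ = ⊥-elim (acyclic (close-path r dr a≢b x∉r xa (Graph.sym T xb)))
      where
      x∉r : x ∉ vertices r
      x∉r x∈r with ∈-++ʷ p (reverseʷ q) (r⊆ x∈r)
      ... | inj₁ x∈p = x∉p x∈p
      ... | inj₂ x∈q = x∉q (∈-reverseʷ q x∈q)

-- A tree rooted at ρ: every vertex x has a unique path `up x` to the root.

module RootedTree (T : Graph) (acyclic : Acyclic T) (connected : Connected T) (ρ : Fin (n T)) where

  open Walks T
  open Forest acyclic

  root-path : ∀ x → Path x ρ
  root-path x = proj₁ (to-path (proj₂ (connected x ρ)))

  root-walk : ∀ x → Walk T x ρ (proj₁ (root-path x))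
  root-walk x = proj₁ (proj₂ (root-path x))

  up : V → List V
  up x = vertices (root-walk x)

  up-distinct : ∀ x → Distinct (up x)
  up-distinct x = proj₂ (proj₂ (root-path x))

  up-linked : ∀ x → Linked _~_ (up x)
  up-linked x = vertices-linked (root-walk x)

  above : V → List V
  above x = proj₁ (vertices-head (root-walk x))

  up-head : ∀ x → up x ≡ x ∷ above x
  up-head x = proj₂ (vertices-head (root-walk x))

  x∈up : ∀ x → x ∈ up x
  x∈up x = subst (x ∈_) (sym (up-head x)) (here refl)

  ρ∈up : ∀ x → ρ ∈ up x
  ρ∈up x = end∈vertices (root-walk x)

  up-unique : ∀ {x l} (w : Walk T x ρ l) → Distinct (vertices w) → vertices w ≡ up x
  up-unique {x} w dw = path-unique w (root-walk x) dw (up-distinct x)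

  up-suffix : ∀ {x y} → y ∈ up x → ∃ λ pre → up x ≡ pre ++ up y
  up-suffix {x} y∈ with drop-until (root-walk x) y∈
  ... | _ , d , pre , eq =
        pre , trans eq (cong (pre ++_) (up-unique d (distinct-++ʳ pre (subst Distinct eq (up-distinct x)))))

  up-⊆ : ∀ {x y} → y ∈ up x → up y ⊆ up x
  up-⊆ y∈ z∈ with up-suffix y∈
  ... | pre , eq = subst (_ ∈_) (sym eq) (∈-++⁺ʳ pre z∈)

  up-edge : ∀ {x y} → x ~ y → up x ≡ x ∷ up y ⊎ up y ≡ y ∷ up x
  up-edge {x} {y} xy with x ∈? up y
  ... | no x∉ = inj₁ (sym (up-unique (cons xy (root-walk y)) (x∉ ∷ up-distinct y)))
  ... | yes x∈ with y ∈? up x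
  ...   | no y∉ = inj₂ (sym (up-unique (cons (Graph.sym T xy) (root-walk x)) (y∉ ∷ up-distinct x)))
  ...   | yes y∈ with up-suffix x∈
  ...     | [] , eq = ⊥-elim (Graph.irrefl T (subst (x ~_) (∷-injectiveˡ (trans (sym (up-head y)) (trans eq (up-head x)))) xy))
  ...     | (p ∷ pre) , eq with ∷-injectiveˡ (trans (sym (up-head y)) eq)
  ...       | refl with subst Distinct eq (up-distinct y)
  ...         | y∉ ∷ _ = ⊥-elim (y∉ (∈-++⁺ʳ pre y∈))

  leaf-below : ∀ {x z} → IsLeaf T x → x ≢ ρ → x ∈ up z → z ≡ x
  leaf-below {x} {z} (_ , _ , only-neighbour) x≢ρ x∈ with up-suffix x∈
  ... | pre , up-z with initLast pre | above x | up-head x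
  ...   | [] | _ | _ = ∷-injectiveˡ (trans (sym (up-head z)) (trans up-z (up-head x)))
  ...   | before ∷ʳ′ c | [] | up-x = ⊥-elim (x≢ρ (ρ∈single (subst (ρ ∈_) up-x (ρ∈up x))))
    where
    ρ∈single : ρ ∈ x ∷ [] → x ≡ ρ
    ρ∈single (here ρ≡x) = sym ρ≡x
  ...   | before ∷ʳ′ c | y ∷ t | up-x =
          ⊥-elim (distinct-disjoint (before ++ c ∷ []) (subst Distinct up-z (up-distinct z))
                    (∈-++⁺ʳ before (here refl)) c∈up-x)
    where
    up-z' : up z ≡ before ++ c ∷ x ∷ y ∷ t
    up-z' = trans up-z (trans (++-assoc before (c ∷ []) (up x)) (cong (λ r → before ++ c ∷ r) up-x))
    c~x : c ~ x
    c~x = Linked.head (linked-++ʳ before (subst (Linked _~_) up-z' (up-linked z)))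
    x~y : x ~ y
    x~y = Linked.head (subst (Linked _~_) up-x (up-linked x))
    c∈up-x : c ∈ up x
    c∈up-x = subst (c ∈_) (sym up-x)
               (there (here (trans (only-neighbour c (Graph.sym T c~x)) (sym (only-neighbour y x~y)))))

  -- Tree distance.  δ x y counts the vertices of up x before it meets up y
  -- and vice versa; it is a lower bound for walk lengths and it is attained
  -- by the walk through the point where the two root paths join.

  exit : List V → List V → ℕ
  exit []       L = 0
  exit (a ∷ as) L with a ∈? L
  ... | yes _ = 0
  ... | no  _ = suc (exit as L)

  exit-here : ∀ {a S L} → a ∈ L → exit (a ∷ S) L ≡ 0
  exit-here {a} {S} {L} a∈ with a ∈? L
  ... | yes _  = refl
  ... | no a∉  = ⊥-elim (a∉ a∈)

  exit-step : ∀ {a S L} → a ∉ L → exit (a ∷ S) L ≡ suc (exit S L)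
  exit-step {a} {S} {L} a∉ with a ∈? L
  ... | yes a∈ = ⊥-elim (a∉ a∈)
  ... | no _   = refl

  exit-++ : ∀ A {S L} → (∀ {z} → z ∈ A → z ∉ L) → exit (A ++ S) L ≡ length A + exit S L
  exit-++ []      _     = refl
  exit-++ (a ∷ A) A-off = trans (exit-step (A-off (here refl))) (cong suc (exit-++ A (A-off ∘ there)))

  exit-cong : ∀ xs {L L'} → (∀ {z} → z ∈ xs → z ∈ L ⇔ z ∈ L') → exit xs L ≡ exit xs L'
  exit-cong []       _    = refl
  exit-cong (a ∷ xs) {L} {L'} same with a ∈? L | a ∈? L'
  ... | yes _  | yes _  = refl
  ... | yes a∈ | no a∉  = ⊥-elim (a∉ (Equivalence.to (same (here refl)) a∈))
  ... | no a∉  | yes a∈ = ⊥-elim (a∉ (Equivalence.from (same (here refl)) a∈))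
  ... | no _   | no _   = cong suc (exit-cong xs (same ∘ there))

  exit-up : ∀ {x L} → x ∈ L → exit (up x) L ≡ 0
  exit-up {x} x∈ = trans (cong (λ xs → exit xs _) (up-head x)) (exit-here x∈)

  δ : V → V → ℕ
  δ x y = exit (up x) (up y) + exit (up y) (up x)

  δ-refl : ∀ x → δ x x ≡ 0
  δ-refl x rewrite exit-up {x} (x∈up x) = refl

  δ-parent-off : ∀ {x y} v → up x ≡ x ∷ up y → x ∉ up v → δ x v ≡ suc (δ y v)
  δ-parent-off {x} {y} v up-x x∉ = cong₂ _+_ x-side v-side
    where
    x-side : exit (up x) (up v) ≡ suc (exit (up y) (up v))
    x-side = trans (cong (λ xs → exit xs (up v)) up-x) (exit-step x∉)
    drop-x : ∀ {z} → z ∈ up v → z ∈ x ∷ up y → z ∈ up y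
    drop-x z∈v (here refl) = ⊥-elim (x∉ z∈v)
    drop-x _   (there z∈y) = z∈y
    same : ∀ {z} → z ∈ up v → z ∈ up x ⇔ z ∈ up y
    same z∈ = mk⇔ (λ z∈x → drop-x z∈ (subst (_ ∈_) up-x z∈x)) (λ z∈y → subst (_ ∈_) (sym up-x) (there z∈y))
    v-side : exit (up v) (up x) ≡ exit (up v) (up y)
    v-side = exit-cong (up v) same

  δ-parent-on : ∀ {x y} v → up x ≡ x ∷ up y → x ∈ up v → suc (δ x v) ≡ δ y v
  δ-parent-on {x} {y} v up-x x∈ with up-suffix x∈
  ... | pre , up-v = begin
      suc (δ x v)      ≡⟨ cong suc (cong₂ _+_ (exit-up x∈) exit-vx) ⟩
      suc (length pre) ≡⟨ ℕP.+-comm 1 (length pre) ⟩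
      length pre + 1   ≡⟨ sym (cong₂ _+_ (exit-up y∈v) exit-vy) ⟩
      δ y v            ∎
    where
    open ≡-Reasoning
    pre-off : ∀ {z} → z ∈ pre → z ∉ up x
    pre-off z∈ = distinct-disjoint pre (subst Distinct up-v (up-distinct v)) z∈
    y∈v : y ∈ up v
    y∈v = up-⊆ x∈ (subst (y ∈_) (sym up-x) (there (x∈up y)))
    x∉y : x ∉ up y
    x∉y with subst Distinct up-x (up-distinct x)
    ... | x∉ ∷ _ = x∉
    exit-vx : exit (up v) (up x) ≡ length pre
    exit-vx = begin
      exit (up v) (up x)               ≡⟨ cong (λ xs → exit xs (up x)) up-v ⟩
      exit (pre ++ up x) (up x)        ≡⟨ exit-++ pre pre-off ⟩
      length pre + exit (up x) (up x)  ≡⟨ cong (length pre +_) (exit-up (x∈up x)) ⟩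
      length pre + 0                   ≡⟨ ℕP.+-identityʳ _ ⟩
      length pre                       ∎
    exit-vy : exit (up v) (up y) ≡ length pre + 1
    exit-vy = begin
      exit (up v) (up y)                   ≡⟨ cong (λ xs → exit xs (up y)) up-v ⟩
      exit (pre ++ up x) (up y)            ≡⟨ exit-++ pre (λ z∈ z∈y → pre-off z∈ (subst (_ ∈_) (sym up-x) (there z∈y))) ⟩
      length pre + exit (up x) (up y)      ≡⟨ cong (λ xs → length pre + exit xs (up y)) up-x ⟩
      length pre + exit (x ∷ up y) (up y)  ≡⟨ cong (length pre +_) (trans (exit-step x∉y) (cong suc (exit-up (x∈up y)))) ⟩
      length pre + 1                       ∎

  δ-parent : ∀ {x y} v → up x ≡ x ∷ up y → δ x v ≤ suc (δ y v) × δ y v ≤ suc (δ x v)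
  δ-parent {x} {y} v up-x with x ∈? up v
  ... | no x∉ = ℕP.≤-reflexive eq , ℕP.m≤n⇒m≤1+n (ℕP.≤-trans (ℕP.n≤1+n _) (ℕP.≤-reflexive (sym eq)))
    where
    eq : δ x v ≡ suc (δ y v)
    eq = δ-parent-off v up-x x∉
  ... | yes x∈ = ℕP.m≤n⇒m≤1+n (ℕP.≤-trans (ℕP.n≤1+n _) (ℕP.≤-reflexive eq)) , ℕP.≤-reflexive (sym eq)
    where
    eq : suc (δ x v) ≡ δ y v
    eq = δ-parent-on v up-x x∈

  δ-edge : ∀ {x y} v → x ~ y → δ x v ≤ suc (δ y v)
  δ-edge v xy with up-edge xy
  ... | inj₁ up-x = proj₁ (δ-parent v up-x)
  ... | inj₂ up-y = proj₂ (δ-parent v up-y)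

  δ≤length : ∀ {x v l} → Walk T x v l → δ x v ≤ l
  δ≤length {x} nil            = ℕP.≤-reflexive (δ-refl x)
  δ≤length {v = v} (cons e w) = ℕP.≤-trans (δ-edge v e) (s≤s (δ≤length w))

  first-in : ∀ xs L {a} → a ∈ xs → a ∈ L →
             ∃ λ A → ∃ λ w → ∃ λ r → xs ≡ A ++ w ∷ r × w ∈ L × (∀ {z} → z ∈ A → z ∉ L)
  first-in (x ∷ xs) L a∈ a∈L with x ∈? L
  ... | yes x∈L = [] , x , xs , refl , x∈L , λ ()
  first-in (x ∷ xs) L (here refl) a∈L | no x∉L = ⊥-elim (x∉L a∈L)
  first-in (x ∷ xs) L (there a∈) a∈L | no x∉L with first-in xs L a∈ a∈L
  ... | A , w , r , eq , w∈L , A-off =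
        x ∷ A , w , r , cong (x ∷_) eq , w∈L , λ { (here refl) → x∉L ; (there z∈) → A-off z∈ }

  record Fork (x y : V) : Set where
    field
      w     : V
      A B   : List V
      up-x  : up x ≡ A ++ up w
      up-y  : up y ≡ B ++ up w
      A-off : ∀ {z} → z ∈ A → z ∉ up y
      B-off : ∀ {z} → z ∈ B → z ∉ up x

  fork-swap : ∀ {x y} → Fork x y → Fork y x
  fork-swap F = record { w = w ; A = B ; B = A ; up-x = up-y ; up-y = up-x ; A-off = B-off ; B-off = A-off }
    where open Fork F

  -- Any two vertices fork: the junction w is the first vertex of up x on up y.
  fork : ∀ x y → Fork x y
  fork x y with first-in (up x) (up y) (ρ∈up x) (ρ∈up y)
  ... | A , w , r , up-x₀ , w∈y , A-off with up-suffix (subst (w ∈_) (sym up-x₀) (∈-++⁺ʳ A (here refl)))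
  ...   | A' , up-x₁ with up-suffix w∈y
  ...     | B , up-y = record { w = w ; A = A ; B = B ; up-x = up-x ; up-y = up-y ; A-off = A-off ; B-off = B-off }
    where
    A≡A' : A ≡ A'
    A≡A' = distinct-prefix A A' (subst Distinct up-x₀ (up-distinct x))
             (trans (sym up-x₀) (trans up-x₁ (cong (A' ++_) (up-head w))))
    up-x : up x ≡ A ++ up w
    up-x = trans up-x₁ (cong (_++ up w) (sym A≡A'))
    B-off : ∀ {z} → z ∈ B → z ∉ up x
    B-off z∈B z∈x with ∈-++⁻ A (subst (_ ∈_) up-x z∈x)
    ... | inj₁ z∈A = A-off z∈A (subst (_ ∈_) (sym up-y) (∈-++⁺ˡ z∈B))
    ... | inj₂ z∈w = distinct-disjoint B (subst Distinct up-y (up-distinct y)) z∈B z∈w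

  module _ {x y} (F : Fork x y) where
    open Fork F

    up-w⊆up-x : up w ⊆ up x
    up-w⊆up-x z∈ = subst (_ ∈_) (sym up-x) (∈-++⁺ʳ A z∈)

    up-w⊆up-y : up w ⊆ up y
    up-w⊆up-y z∈ = subst (_ ∈_) (sym up-y) (∈-++⁺ʳ B z∈)

    δ-fork : δ x y ≡ length A + length B
    δ-fork = cong₂ _+_ (exit-segment up-x A-off (up-w⊆up-y (x∈up w)))
                       (exit-segment up-y B-off (up-w⊆up-x (x∈up w)))
      where
      exit-segment : ∀ {s t C} → up s ≡ C ++ up w → (∀ {z} → z ∈ C → z ∉ up t) → w ∈ up t →
                     exit (up s) (up t) ≡ length C
      exit-segment {s} {t} {C} up-s C-off w∈t = begin
        exit (up s) (up t)             ≡⟨ cong (λ xs → exit xs (up t)) up-s ⟩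
        exit (C ++ up w) (up t)        ≡⟨ exit-++ C C-off ⟩
        length C + exit (up w) (up t)  ≡⟨ cong (length C +_) (exit-up w∈t) ⟩
        length C + 0                   ≡⟨ ℕP.+-identityʳ _ ⟩
        length C                       ∎
        where open ≡-Reasoning

    A-starts : x ∉ up y → ∃ λ A₀ → A ≡ x ∷ A₀
    A-starts x∉ with A | up-x
    ... | []     | up-x' = ⊥-elim (x∉ (up-w⊆up-y (subst (x ∈_) up-x' (x∈up x))))
    ... | a ∷ A₀ | up-x' = A₀ , cong (_∷ A₀) (sym (∷-injectiveˡ (trans (sym (up-head x)) up-x')))

    walk-to-junction : x ∉ up y → Walk T x w (length A)
    walk-to-junction x∉ with A-starts x∉
    ... | A₀ , refl = walk-along x A₀ w (above w) (subst (Linked _~_) up-x' (up-linked x))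
      where
      up-x' : up x ≡ x ∷ A₀ ++ w ∷ above w
      up-x' = trans up-x (cong (x ∷_) (cong (A₀ ++_) (up-head w)))

  dist-fork : ∀ {x y} k (F : Fork x y) → x ∉ up y → y ∉ up x →
              DistLe T x y k ⇔ length (Fork.A F) + length (Fork.B F) ≤ k
  dist-fork k F x∉ y∉ = mk⇔
    (λ { (l , l≤k , walk) → ℕP.≤-trans (ℕP.≤-reflexive (sym (δ-fork F))) (ℕP.≤-trans (δ≤length walk) l≤k) })
    (λ ≤k → _ , ≤k , walk-to-junction F x∉ ++ʷ reverseʷ (walk-to-junction (fork-swap F) y∉))

-- Ranks and hulls of finite families of points.

module _ {A : Set} {P Q : A → Set} (P? : Decidable P) (Q? : Decidable Q) (P⇒Q : ∀ {x} → P x → Q x) where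

  filter-mono : ∀ xs → length (filter P? xs) ≤ length (filter Q? xs)
  filter-mono []       = z≤n
  filter-mono (x ∷ xs) with P? x | Q? x
  ... | yes _  | yes _  = s≤s (filter-mono xs)
  ... | yes px | no ¬qx = ⊥-elim (¬qx (P⇒Q px))
  ... | no _   | yes _  = ℕP.m≤n⇒m≤1+n (filter-mono xs)
  ... | no _   | no _   = filter-mono xs

  filter-strict : ∀ xs {y} → y ∈ xs → ¬ P y → Q y → length (filter P? xs) < length (filter Q? xs)
  filter-strict (x ∷ xs) (here refl) ¬py qy with P? x | Q? x
  ... | yes py | _      = ⊥-elim (¬py py)
  ... | no _   | yes _  = s≤s (filter-mono xs)
  ... | no _   | no ¬qy = ⊥-elim (¬qy qy)
  filter-strict (x ∷ xs) (there y∈) ¬py qy with P? x | Q? x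
  ... | yes _  | yes _  = s≤s (filter-strict xs y∈ ¬py qy)
  ... | yes px | no ¬qx = ⊥-elim (¬qx (P⇒Q px))
  ... | no _   | yes _  = ℕP.m≤n⇒m≤1+n (filter-strict xs y∈ ¬py qy)
  ... | no _   | no _   = filter-strict xs y∈ ¬py qy

module Rank {A : Set} {_≺_ : A → A → Set} (≺-trans : Transitive _≺_) (≺-irrefl : ∀ {a} → ¬ a ≺ a)
            (_≺?_ : Decidable₂ _≺_) {m : ℕ} (s : Fin m → A) where

  rank : Fin m → ℕ
  rank z = suc (length (filter (λ t → s t ≺? s z) (allFin m)))

  rank-mono : ∀ {u v} → s u ≺ s v → rank u < rank v
  rank-mono {u} {v} u≺v = s≤s (filter-strict (λ t → s t ≺? s u) (λ t → s t ≺? s v)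
                                (λ t≺u → ≺-trans t≺u u≺v) (allFin m) (∈-allFin u) ≺-irrefl u≺v)

  rank-positive : ∀ z → 0 < rank z
  rank-positive z = s≤s z≤n

  rank-bounded : ∀ z → rank z ≤ suc (length (allFin m))
  rank-bounded z = s≤s (length-filter (λ t → s t ≺? s z) (allFin m))

-- The hull of a set of points: the least interval [start , end] containing their
-- positions (an empty set has the hull [1 + bound , 0]).
module Hull {m : ℕ} (pos : Fin m → ℕ) (bound : ℕ) (pos-positive : ∀ z → 0 < pos z) (pos≤bound : ∀ z → pos z ≤ bound)
            {X : Set} {Mem : X → Fin m → Set} (Mem? : ∀ x → Decidable (Mem x)) where

  members : X → List (Fin m)
  members x = filter (Mem? x) (allFin m)

  start end : X → ℕ
  start x = min (suc bound) (map pos (members x))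
  end x = max 0 (map pos (members x))

  all-positions : ∀ {P : ℕ → Set} x → (∀ {z} → Mem x z → P (pos z)) → All P (map pos (members x))
  all-positions x h = All.map⁺ (All.tabulate (λ z∈ → h (proj₂ (∈-filter⁻ (Mem? x) {xs = allFin m} z∈))))

  position∈ : ∀ {x z} → Mem x z → Any (pos z ≡_) (map pos (members x))
  position∈ {x} {z} mem = Any.map⁺ (Any.map (cong pos) (∈-filter⁺ (Mem? x) (∈-allFin z) mem))

  start≤ : ∀ {x z} → Mem x z → start x ≤ pos z
  start≤ {x} mem = min≤v⁺ (suc bound) (map pos (members x)) (inj₂ (Any.map ℕP.≤-reflexive (Any.map sym (position∈ mem))))

  ≤end : ∀ {x z} → Mem x z → pos z ≤ end x
  ≤end {x} mem = v≤max⁺ 0 (map pos (members x)) (inj₂ (Any.map ℕP.≤-reflexive (position∈ mem)))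

  end<start : ∀ {x y} → (∀ {z z'} → Mem x z → Mem y z' → pos z < pos z') → end x < start y
  end<start {x} {y} before = max<v⁺ (below-start (s≤s z≤n) (λ z _ → pos-positive z))
                                (all-positions x λ mem → below-start (s≤s (pos≤bound _)) (λ _ mem' → before mem mem'))
    where
    below-start : ∀ {p} → p < suc bound → (∀ z → Mem y z → p < pos z) → p < start y
    below-start p<top p<y = v<min⁺ p<top (all-positions y (p<y _))

_<ˡ_ : List ℕ → List ℕ → Set
_<ˡ_ = Lex-< _≡_ _<_

<ˡ-trans : Transitive _<ˡ_
<ˡ-trans = Lex.<-transitive isEquivalence ℕP.<-resp₂-≡ ℕP.<-trans

<ˡ-irrefl : ∀ {xs} → ¬ xs <ˡ xs
<ˡ-irrefl = Lex.<-irreflexive ℕP.<-irrefl (Pointwise.refl refl)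

_<ˡ?_ : Decidable₂ _<ˡ_
_<ˡ?_ = Lex.<-decidable ℕP._≟_ ℕP._<?_

<ˡ-after : ∀ C {a b xs ys} → a < b → (C ++ a ∷ xs) <ˡ (C ++ b ∷ ys)
<ˡ-after []      a<b = Lex.this a<b
<ˡ-after (c ∷ C) a<b = Lex.next refl (<ˡ-after C a<b)

ℕ→ℚ : ℕ → ℚ
ℕ→ℚ k = mkℚ (ℤ.+ k) 0 (Coprime.sym (1-coprimeTo k))

ℕ→ℚ-mono : ∀ {i j} → i ≤ j → ℕ→ℚ i ≤ℚ ℕ→ℚ j
ℕ→ℚ-mono {i} {j} i≤j = *≤* (subst₂ ℤ._≤_ (sym (ℤP.*-identityʳ (ℤ.+ i))) (sym (ℤP.*-identityʳ (ℤ.+ j))) (ℤ.+≤+ i≤j))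

ℕ→ℚ-reflect : ∀ {i j} → ℕ→ℚ i ≤ℚ ℕ→ℚ j → i ≤ j
ℕ→ℚ-reflect {i} {j} (*≤* ≤ℤ) with subst₂ ℤ._≤_ (ℤP.*-identityʳ (ℤ.+ i)) (ℤP.*-identityʳ (ℤ.+ j)) ≤ℤ
... | ℤ.+≤+ i≤j = i≤j

-- Two boxes in dimension d will
-- meet in coordinate i exactly when du ≤ i or dv ≤ d ∸ i, where du and dv are
-- the lengths of the two branches of a fork; this happens in every coordinate
-- exactly when du + dv ≤ d + 1, provided dv = 1 forces du = 1.

criterion⇒ : ∀ d du dv → du + dv ≤ suc d → ∀ i → du ≤ i ⊎ dv ≤ d ∸ i
criterion⇒ d du dv sum≤ i with du ℕ.≤? i
... | yes du≤i = inj₁ du≤i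
... | no du≰i  = inj₂ (ℕP.≤-trans dv≤ (ℕP.∸-monoʳ-≤ (suc d) (ℕP.≰⇒> du≰i)))
  where
  dv≤ : dv ≤ suc d ∸ du
  dv≤ = ℕP.m+n≤o⇒m≤o∸n dv (subst (_≤ suc d) (ℕP.+-comm du dv) sum≤)

criterion⇐ : ∀ d du dv → 1 ≤ d → 1 ≤ du → 1 ≤ dv → (dv ≡ 1 → du ≡ 1) →
             (∀ i → i < d → du ≤ i ⊎ dv ≤ d ∸ i) → du + dv ≤ suc d
criterion⇐ (suc e) (suc j) dv _ _ dv≥1 dv1⇒du1 cover with j <? suc e
... | yes j<d with cover j j<d
...   | inj₁ du≤j = ⊥-elim (ℕP.n≮n j du≤j)
...   | inj₂ dv≤  = s≤s (subst (_≤ suc e) (ℕP.+-comm dv j) (ℕP.m≤o∸n⇒m+n≤o dv (ℕP.<⇒≤ j<d) dv≤))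
criterion⇐ (suc e) (suc j) dv _ _ dv≥1 dv1⇒du1 cover | no j≮d with cover e (ℕP.n<1+n e)
...   | inj₁ du≤e = ⊥-elim (j≮d (s≤s (ℕP.≤-trans (ℕP.n≤1+n j) du≤e)))
...   | inj₂ dv≤1 with dv1⇒du1 (ℕP.≤-antisym (subst (dv ≤_) (ℕP.m+n∸n≡m 1 e) dv≤1) dv≥1)
...     | refl = ⊥-elim (j≮d (s≤s z≤n))

module Construction
  (d : ℕ) (d≥1 : 1 ≤ d) (G T : Graph) (connected : Connected T) (acyclic : Acyclic T)
  (f : Fin (n G) → Fin (n T)) (f-injective : Injective _≡_ _≡_ f) (f-leaf : ∀ v → IsLeaf T (f v))
  (f-adj : ∀ u v → u ≢ v → (Adj G u v ⇔ DistLe T (f u) (f v) (suc d)))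
  (ρ : Fin (n T)) (ρ-inner : ∀ v → f v ≢ ρ) where

  open Walks T
  open RootedTree T acyclic connected ρ

  m : ℕ
  m = n G

  leaf-off : ∀ {u v} → u ≢ v → f u ∉ up (f v)
  leaf-off {u} u≢v fu∈ = u≢v (f-injective (sym (leaf-below (f-leaf u) (ρ-inner u) fu∈)))

  is-leaf? : (c : V) → Dec (∃ λ v → f v ≡ c)
  is-leaf? c = FinP.any? (λ v → f v FinP.≟ c)

  key : V → ℕ
  key c with is-leaf? c
  ... | yes _ = toℕ c
  ... | no  _ = n T + toℕ c

  key-leaf : ∀ v → key (f v) ≡ toℕ (f v)
  key-leaf v with is-leaf? (f v)
  ... | yes _ = refl
  ... | no ¬leaf = ⊥-elim (¬leaf (v , refl))

  key-small : ∀ c → key c < n T → ∃ λ v → f v ≡ c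
  key-small c small with is-leaf? c
  ... | yes leaf = leaf
  ... | no _     = ⊥-elim (ℕP.m+n≮m (n T) (toℕ c) small)

  key-injective : ∀ {c c'} → key c ≡ key c' → c ≡ c'
  key-injective {c} {c'} eq with is-leaf? c | is-leaf? c'
  ... | yes _ | yes _ = FinP.toℕ-injective eq
  ... | no _  | no _  = FinP.toℕ-injective (ℕP.+-cancelˡ-≡ (n T) _ _ eq)
  ... | yes _ | no _  = ⊥-elim (ℕP.<-irrefl eq (ℕP.<-≤-trans (FinP.toℕ<n c) (ℕP.m≤m+n (n T) (toℕ c'))))
  ... | no _  | yes _ = ⊥-elim (ℕP.<-irrefl (sym eq) (ℕP.<-≤-trans (FinP.toℕ<n c') (ℕP.m≤m+n (n T) (toℕ c))))

  -- Ranking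
  -- the leaves lexicographically by descent is a depth-first order in which
  -- the leaf children of a vertex come before its other children.
  descent : Fin m → List ℕ
  descent z = reverse (map key (up (f z)))

  open Rank <ˡ-trans <ˡ-irrefl _<ˡ?_ descent using (rank; rank-mono; rank-positive; rank-bounded)

  open Hull rank (suc (length (allFin m))) rank-positive rank-bounded (λ x z → x ∈? up (f z))
    using (start; end; start≤; ≤end; end<start)

  -- The ancestor of x at height j (the root if j exceeds the depth of x).
  ancestor : ℕ → V → V
  ancestor j x = nth ρ (up x) j

  ancestor∈ : ∀ j x → ancestor j x ∈ up x
  ancestor∈ j x with nth-∈ ρ (up x) j
  ... | inj₁ a∈   = a∈
  ... | inj₂ a≡ρ = subst (_∈ up x) (sym a≡ρ) (ρ∈up x)

  ancestor-low : ∀ {x A S} j → up x ≡ A ++ S → j < length A → ancestor j x ∈ A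
  ancestor-low {x} {A} j up-x j< = subst (λ xs → nth ρ xs j ∈ A) (sym up-x) (nth-∈-prefix ρ A j j<)

  ancestor-high : ∀ {x A w} j → up x ≡ A ++ up w → length A ≤ j → ancestor j x ∈ up w
  ancestor-high {x} {A} {w} j up-x A≤j
    rewrite up-x | nth-skip-prefix ρ A {up w} j A≤j = ancestor∈ (j ∸ length A) w

  box : Fin m → Box d
  box u = record
    { lo    = λ i → ℕ→ℚ (start (ancestor (d ∸ toℕ i) (f u)))
    ; hi    = λ i → ℕ→ℚ (end (ancestor (toℕ i) (f u)))
    ; lo≤hi = λ i → ℕ→ℚ-mono (ℕP.≤-trans (start≤ (ancestor∈ _ (f u))) (≤end (ancestor∈ _ (f u))))
    }

  -- The two branches of the fork of f u and f v: they run from the leaves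
  -- up to the children cu and cv of the junction w.
  record Branches (u v : Fin m) : Set where
    field
      fork-uv : Fork (f u) (f v)
    open Fork fork-uv public
    field
      A' B'  : List V
      cu cv  : V
      A-last : A ≡ A' ++ cu ∷ []
      B-last : B ≡ B' ++ cv ∷ []

  branches : ∀ {u v} → u ≢ v → Branches u v
  branches {u} {v} u≢v with A-starts F (leaf-off u≢v) | A-starts (fork-swap F) (leaf-off (u≢v ∘ sym))
    where F = fork (f u) (f v)
  ... | A₀ , A≡ | B₀ , B≡ with last-view _ (subst (f u ∈_) (sym A≡) (here refl))
                              | last-view _ (subst (f v ∈_) (sym B≡) (here refl))
  ...   | A' , cu , A-last | B' , cv , B-last =
          record { fork-uv = fork (f u) (f v) ; A' = A' ; B' = B' ; cu = cu ; cv = cv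
                 ; A-last = A-last ; B-last = B-last }

  swap-branches : ∀ {u v} → Branches u v → Branches v u
  swap-branches br = record { fork-uv = fork-swap fork-uv ; A' = B' ; B' = A' ; cu = cv ; cv = cu
                            ; A-last = B-last ; B-last = A-last }
    where open Branches br

  module _ {u v} (br : Branches u v) where
    open Branches br

    up-u : up (f u) ≡ A' ++ cu ∷ up w
    up-u = trans up-x (trans (cong (_++ up w) A-last) (++-assoc A' (cu ∷ []) (up w)))

    leaf∈A : f u ∈ A
    leaf∈A = subst (f u ∈_) (sym A-last)
               (head∈prefix A' (trans (sym (up-head (f u))) (trans up-x (cong (_++ up w) A-last))))

    cu∈A : cu ∈ A
    cu∈A = subst (cu ∈_) (sym A-last) (∈-++⁺ʳ A' (here refl))

    A⊆up-u : A ⊆ up (f u)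
    A⊆up-u a∈ = subst (_ ∈_) (sym up-x) (∈-++⁺ˡ a∈)

    descent-through-cu : ∀ {a z} → a ∈ A → a ∈ up (f z) →
                         ∃ λ X → descent z ≡ reverse (map key (up w)) ++ key cu ∷ X
    descent-through-cu {a} {z} a∈A a∈z with up-suffix a∈z | up-suffix (A⊆up-u a∈A)
    ... | pre , up-z | pre' , up-u≡ with suffix-from-earlier pre' A' distinct (subst (a ∈_) A-last a∈A) split
      where
      distinct : Distinct (pre' ++ a ∷ above a)
      distinct = subst Distinct (trans up-u≡ (cong (pre' ++_) (up-head a))) (up-distinct (f u))
      split : pre' ++ a ∷ above a ≡ A' ++ cu ∷ up w
      split = trans (cong (pre' ++_) (sym (up-head a))) (trans (sym up-u≡) up-u)
    ...   | C , up-a = reverse (map key (pre ++ C)) , (begin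
            descent z                                  ≡⟨ cong (reverse ∘ map key) up-z' ⟩
            reverse (map key ((pre ++ C) ++ cu ∷ up w)) ≡⟨ reverse-map-split key (pre ++ C) cu (up w) ⟩
            reverse (map key (up w)) ++ key cu ∷ reverse (map key (pre ++ C)) ∎)
      where
      open ≡-Reasoning
      up-z' : up (f z) ≡ (pre ++ C) ++ cu ∷ up w
      up-z' = trans up-z (trans (cong (pre ++_) (trans (up-head a) up-a)) (sym (++-assoc pre C (cu ∷ up w))))

  branches-ordered : ∀ {u v} (br : Branches u v) → key (Branches.cu br) < key (Branches.cv br) →
                     ∀ {a b z z'} → a ∈ Branches.A br → b ∈ Branches.B br →
                     a ∈ up (f z) → b ∈ up (f z') → rank z < rank z'
  branches-ordered br cu<cv a∈A b∈B a∈z b∈z'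
    with descent-through-cu br a∈A a∈z | descent-through-cu (swap-branches br) b∈B b∈z'
  ... | X , desc-z | Y , desc-z' =
        rank-mono (subst₂ _<ˡ_ (sym desc-z) (sym desc-z') (<ˡ-after (reverse (map key (up (Branches.w br)))) cu<cv))

  leaf-child-first : ∀ {u v} (br : Branches u v) → key (Branches.cu br) < key (Branches.cv br) →
                     length (Branches.B br) ≡ 1 → length (Branches.A br) ≡ 1
  leaf-child-first {u} {v} br cu<cv |B|≡1 = cong length (trans A-last (cong (_++ cu ∷ []) A'≡[]))
    where
    open Branches br
    B'≡[] : B' ≡ []
    B'≡[] = single-last B' (trans (cong length (sym B-last)) |B|≡1)
    fv≡cv : f v ≡ cv
    fv≡cv with subst (f v ∈_) (trans B-last (cong (_++ cv ∷ []) B'≡[])) (leaf∈A (swap-branches br))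
    ... | here eq = eq
    cu-leaf : ∃ λ t → f t ≡ cu
    cu-leaf = key-small cu (ℕP.<-≤-trans cu<cv (ℕP.≤-trans (ℕP.≤-reflexive (trans (cong key (sym fv≡cv)) (key-leaf v)))
                                                            (ℕP.<⇒≤ (FinP.toℕ<n (f v)))))
    fu≡cu : f u ≡ cu
    fu≡cu with cu-leaf
    ... | t , ft≡cu = trans (leaf-below (f-leaf t) (ρ-inner t) (subst (_∈ up (f u)) (sym ft≡cu) (A⊆up-u br (cu∈A br)))) ft≡cu
    A'≡[] : A' ≡ []
    A'≡[] = sym (distinct-prefix [] A' (subst Distinct (up-head (f u)) (up-distinct (f u)))
                  (trans (sym (up-head (f u))) (trans (up-u br) (cong (λ c → A' ++ c ∷ up w) (sym fu≡cu)))))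

  module Coordinates {u v} (br : Branches u v) (cu<cv : key (Branches.cu br) < key (Branches.cv br)) where
    open Branches br

    du dv : ℕ
    du = length A
    dv = length B

    ordered : ∀ {a b z z'} → a ∈ A → b ∈ B → a ∈ up (f z) → b ∈ up (f z') → rank z < rank z'
    ordered = branches-ordered br cu<cv

    left-meets : ∀ i → lo (box u) i ≤ℚ hi (box v) i
    left-meets i = ℕ→ℚ-mono (ℕP.≤-trans (start≤ (ancestor∈ _ (f u)))
                     (ℕP.<⇒≤ (ℕP.<-≤-trans (ordered (leaf∈A br) (leaf∈A (swap-branches br)) (x∈up (f u)) (x∈up (f v)))
                                          (≤end (ancestor∈ _ (f v))))))

    right-meets⇐ : ∀ i → du ≤ toℕ i ⊎ dv ≤ d ∸ toℕ i → lo (box v) i ≤ℚ hi (box u) i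
    right-meets⇐ i (inj₁ du≤i) = ℕ→ℚ-mono (ℕP.≤-trans (start≤ (ancestor∈ _ (f v)))
                                   (≤end (up-w⊆up-y fork-uv (ancestor-high (toℕ i) up-x du≤i))))
    right-meets⇐ i (inj₂ dv≤)  = ℕ→ℚ-mono (ℕP.≤-trans (start≤ (up-w⊆up-x fork-uv (ancestor-high (d ∸ toℕ i) up-y dv≤)))
                                   (≤end (ancestor∈ _ (f u))))

    right-meets⇒ : ∀ i → lo (box v) i ≤ℚ hi (box u) i → du ≤ toℕ i ⊎ dv ≤ d ∸ toℕ i
    right-meets⇒ i meets with du ℕ.≤? toℕ i | dv ℕ.≤? d ∸ toℕ i
    ... | yes du≤i | _        = inj₁ du≤i
    ... | no _     | yes dv≤  = inj₂ dv≤
    ... | no du≰i  | no dv≰   = ⊥-elim (ℕP.<⇒≱ separated (ℕ→ℚ-reflect meets))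
      where
      separated : end (ancestor (toℕ i) (f u)) < start (ancestor (d ∸ toℕ i) (f v))
      separated = end<start (ordered (ancestor-low (toℕ i) up-x (ℕP.≰⇒> du≰i))
                                     (ancestor-low (d ∸ toℕ i) up-y (ℕP.≰⇒> dv≰)))

    meets⇔ : Intersect (box u) (box v) ⇔ du + dv ≤ suc d
    meets⇔ = mk⇔ to from
      where
      to : Intersect (box u) (box v) → du + dv ≤ suc d
      to meets = criterion⇐ d du dv d≥1 (nonempty-length (leaf∈A br)) (nonempty-length (leaf∈A (swap-branches br)))
                   (leaf-child-first br cu<cv)
                   (λ j j<d → subst (λ j' → du ≤ j' ⊎ dv ≤ d ∸ j') (FinP.toℕ-fromℕ< j<d)
                                    (right-meets⇒ (Fin.fromℕ< j<d) (proj₂ (meets (Fin.fromℕ< j<d)))))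
      from : du + dv ≤ suc d → Intersect (box u) (box v)
      from sum≤ i = left-meets i , right-meets⇐ i (criterion⇒ d du dv sum≤ (toℕ i))

    adjacency : u ≢ v → Adj G u v ⇔ Intersect (box u) (box v)
    adjacency u≢v = ⇔.trans (f-adj u v u≢v)
                      (⇔.trans (dist-fork (suc d) fork-uv (leaf-off u≢v) (leaf-off (u≢v ∘ sym))) (⇔.sym meets⇔))

  intersect-sym : ∀ {t} {B C : Box t} → Intersect B C → Intersect C B
  intersect-sym meets i = proj₂ (meets i) , proj₁ (meets i)

  -- The boxes represent G: order each pair of leaves so that cu precedes cv
  -- (equal keys are impossible, as cu lies off up (f v) while cv lies on it).
  box-rep : BoxRep G d
  box-rep = box , adjacency
    where
    adjacency : ∀ u v → u ≢ v → Adj G u v ⇔ Intersect (box u) (box v)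
    adjacency u v u≢v with branches u≢v
    ... | br with ℕP.<-cmp (key (Branches.cu br)) (key (Branches.cv br))
    ...   | tri< cu<cv _ _ = Coordinates.adjacency br cu<cv u≢v
    ...   | tri≈ _ same _  = ⊥-elim (Branches.A-off br (cu∈A br)
                               (subst (_∈ up (f v)) (sym (key-injective same)) (A⊆up-u (swap-branches br) (cu∈A (swap-branches br)))))
    ...   | tri> _ _ cv<cu = ⇔.trans (mk⇔ (Graph.sym G) (Graph.sym G))
                               (⇔.trans (Coordinates.adjacency (swap-branches br) cv<cu (u≢v ∘ sym))
                                        (mk⇔ (intersect-sym {B = box v} {C = box u}) (intersect-sym {B = box u} {C = box v})))

-- The degenerate cases: no vertices, or a tree that is a single edge.

empty-or-inhabited : ∀ m → (Fin m → ⊥) ⊎ Fin m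
empty-or-inhabited zero    = inj₁ λ ()
empty-or-inhabited (suc m) = inj₂ Fin.zero

complete-boxicity : ∀ t (G : Graph) → (∀ u v → u ≢ v → Adj G u v) → BoxicityLe G t
complete-boxicity t G complete = 0 , z≤n , (λ _ → point) , λ u v u≢v → mk⇔ (λ _ ()) (λ _ → complete u v u≢v)
  where
  point : Box 0
  point = record { lo = λ () ; hi = λ () ; lo≤hi = λ () }

single-edge : ∀ (T : Graph) → Connected T → ∀ {x y} → (∀ z → Adj T x z → z ≡ y) → (∀ z → Adj T y z → z ≡ x) →
              ∀ z → z ≡ x ⊎ z ≡ y
single-edge T connected {x} {y} only-x only-y z = stay (inj₁ refl) (proj₂ (connected x z))
  where
  stay : ∀ {a b l} → a ≡ x ⊎ a ≡ y → Walk T a b l → b ≡ x ⊎ b ≡ y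
  stay a∈ nil                       = a∈
  stay (inj₁ refl) (cons {w = c} e w) = stay (inj₂ (only-x c e)) w
  stay (inj₂ refl) (cons {w = c} e w) = stay (inj₁ (only-y c e)) w

-- If two leaves of a leaf-power representation are adjacent in the tree, the
-- tree is that single edge, so G is complete.
adjacent-leaves-complete :
  ∀ k (G T : Graph) → Connected T → (f : Fin (n G) → Fin (n T)) → Injective _≡_ _≡_ f →
  (∀ v → IsLeaf T (f v)) → (∀ u v → u ≢ v → (Adj G u v ⇔ DistLe T (f u) (f v) (suc k))) →
  ∀ {u₀ v₀} → Adj T (f u₀) (f v₀) → ∀ u u' → u ≢ u' → Adj G u u'
adjacent-leaves-complete k G T connected f f-injective f-leaf f-adj {u₀} {v₀} e u u' u≢u' =
  Equivalence.from (f-adj u u' u≢u') (close (edge (f u)) (edge (f u')))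
  where
  only-neighbour : ∀ {a b} → IsLeaf T a → Adj T a b → ∀ z → Adj T a z → z ≡ b
  only-neighbour (_ , _ , only) a~b z a~z = trans (only z a~z) (sym (only _ a~b))
  edge : ∀ z → z ≡ f u₀ ⊎ z ≡ f v₀
  edge = single-edge T connected (only-neighbour (f-leaf u₀) e) (only-neighbour (f-leaf v₀) (Graph.sym T e))
  one-step : ∀ {a b} → Adj T a b → DistLe T a b (suc k)
  one-step a~b = 1 , s≤s z≤n , cons a~b nil
  close : f u ≡ f u₀ ⊎ f u ≡ f v₀ → f u' ≡ f u₀ ⊎ f u' ≡ f v₀ → DistLe T (f u) (f u') (suc k)
  close (inj₁ p) (inj₁ q) = ⊥-elim (u≢u' (f-injective (trans p (sym q))))
  close (inj₂ p) (inj₂ q) = ⊥-elim (u≢u' (f-injective (trans p (sym q))))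
  close (inj₁ p) (inj₂ q) rewrite p | q = one-step e
  close (inj₂ p) (inj₁ q) rewrite p | q = one-step (Graph.sym T e)

corollary1 : (k : ℕ) → 2 ≤ k → (G : Graph) → IsLeafPower k G → BoxicityLe G (k ∸ 1)
corollary1 (suc d) (s≤s d≥1) G (T , (connected , acyclic) , f , f-injective , f-leaf , _ , f-adj)
  with empty-or-inhabited (n G)
... | inj₁ no-vertex = complete-boxicity d G (λ u → ⊥-elim (no-vertex u))
... | inj₂ u₀ with f-leaf u₀
...   | y , u₀~y , _ with FinP.any? (λ v → f v FinP.≟ y)
...     | no y-inner = d , ℕP.≤-refl ,
          Construction.box-rep d d≥1 G T connected acyclic f f-injective f-leaf f-adj y (λ v fv≡y → y-inner (v , fv≡y))
...     | yes (v , refl) =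
          complete-boxicity d G (adjacent-leaves-complete d G T connected f f-injective f-leaf f-adj u₀~y)
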